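{- Let $q$ be a prime power, $Q=q^m$, let $\mathbf H=[\mathbf h_1,\dots,\mathbf h_n]$ be an $r\times n$ matrix over $\mathbb F_q$ and $\mathbf s\in\mathbb F_q^r$ a column vector. Let $\boldsymbol\beta=(\beta_1,\dots,\beta_n)\in\mathbb F_Q^n$ and let $\mathbf x\in\mathbb F_Q^n$ satisfy $\mathbf H(\boldsymbol\beta)\,{}^t\mathbf x=\mathbf s$. Let $w_H$ be the minimum Hamming weight of a vector $x\in\mathbb F_q^n$ with $\mathbf H\,{}^t x=\mathbf s$. Then, if $J\subseteq\{1,\dots,n\}$ is the Hamming support of $\mathbf x$, there exists a subset $W\subseteq J$ with $|W|=w_H$ such that the columns $(\mathbf h_j)_{j\in W}$ of $\mathbf H$ are $\mathbb F_Q$-linearly independent.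
   Context: $\mathbf H(\boldsymbol\beta)$ denotes the $r\times n$ matrix over $\mathbb F_Q$ given by $[\beta_1\mathbf h_1,\beta_2\mathbf h_2,\dots,\beta_n\mathbf h_n]$. -}

module Defs where

open import Level using (0ℓ)
open import Data.Nat as ℕ using (ℕ; _^_; _≥_)
open import Data.Nat.Primality using (Prime)
open import Data.Fin as Fin using (Fin)
open import Data.Fin.Subset using (Subset; _∈_; _∉_; _⊆_; ∣_∣)
open import Data.Product using (Σ; ∃; ∃-syntax; _×_)
open import Data.Empty using (⊥)
open import Relation.Nullary using (¬_)
open import Relation.Binary.PropositionalEquality as ≡ using (_≡_)
open import Function.Bundles using (Inverse; _⇔_)
open import Algebra.Bundles using (CommutativeRing)
open import Algebra.Morphism.Structures using (module RingMorphisms)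

IsPrimePower : ℕ → Set
IsPrimePower q = ∃[ p ] ∃[ k ] (Prime p × k ≥ 1 × q ≡ p ^ k)

record Field : Set₁ where
  field
    commRing : CommutativeRing 0ℓ 0ℓ
  open CommutativeRing commRing public
  field
    0≉1     : ¬ (0# ≈ 1#)
    inverse : ∀ x → ¬ (x ≈ 0#) → ∃[ y ] (x * y ≈ 1#)

HasCard : Field → ℕ → Set
HasCard F c = Inverse (≡.setoid (Fin c)) (Field.setoid F)

IsFieldEmbedding : (F K : Field) → (Field.Carrier F → Field.Carrier K) → Set
IsFieldEmbedding F K ι =
  RingMorphisms.IsRingMonomorphism (Field.rawRing F) (Field.rawRing K) ι

module _ (F : Field) where
  open Field F

  Σᶠ : ∀ {n} → (Fin n → Carrier) → Carrier
  Σᶠ {ℕ.zero}  v = 0#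
  Σᶠ {ℕ.suc n} v = v Fin.zero + Σᶠ (λ j → v (Fin.suc j))

  IsSupport : ∀ {n} → (Fin n → Carrier) → Subset n → Set
  IsSupport x J = ∀ j → (j ∈ J) ⇔ (¬ (x j ≈ 0#))

  HasWeight : ∀ {n} → (Fin n → Carrier) → ℕ → Set
  HasWeight x w = ∃[ J ] (IsSupport x J × ∣ J ∣ ≡ w)

  LinIndep : ∀ {r n} → (Fin n → Fin r → Carrier) → Subset n → Set
  LinIndep {r} {n} v W =
    ∀ (c : Fin n → Carrier) →
      (∀ j → j ∉ W → c j ≈ 0#) →
      (∀ i → Σᶠ (λ j → c j * v j i) ≈ 0#) →
      ∀ j → j ∈ W → c j ≈ 0#

-- Put cⱼ := βⱼ xⱼ, so that Σⱼ cⱼ hⱼ = s with c supported in J: the system has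
-- coefficients in F_q and a solution over F_Q.  Gaussian elimination over F_q along the
-- columns in J keeps as pivots the columns that stay nonzero after eliminating the earlier
-- pivots.  Elimination commutes with the embedding, so the pivots are F_Q-independent, and
-- back-substitution gives a solution y over F_q supported on the pivots.  Hence
-- wH ≤ weight(y) ≤ #pivots, and any wH pivots do the job.
module Submission where

open import Data.Nat using (ℕ; zero; suc; _≤_; z≤n; s≤s; _^_)
open import Data.Nat.Properties using (≤-trans)
open import Data.Fin as Fin using (Fin; zero; suc)
open import Data.Fin.Properties using (all?; ¬∀⟶∃¬)
open import Data.Fin.Subset using (Subset; _∈_; _∉_; _⊆_; ∣_∣; inside; outside)
open import Data.Fin.Subset.Properties
  using (_∈?_; drop-there; out⊆; in⊆in; ⊆-trans; p⊆q⇒∣p∣≤∣q∣)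
open import Data.Vec using ([]; _∷_; here; there)
import Data.Vec.Functional as Vector
open import Data.Product using (∃-syntax; _×_; _,_; proj₁; proj₂)
open import Data.Sum using (_⊎_; inj₁; inj₂)
open import Function using (_∘_)
open import Function.Bundles using (Equivalence; _⇔_; mk⇔)
open import Function.Properties.Inverse using (Inverse⇒Injection)
open import Function.Construct.Symmetry using () renaming (inverse to Inverse-sym)
open import Relation.Nullary using (¬_; yes; no; does; contradiction)
open import Relation.Nullary.Decidable using (¬?; via-injection; decidable-stable)
open import Relation.Unary as U using (Pred)
open import Relation.Binary.Definitions using (Decidable)
open import Relation.Binary.PropositionalEquality as ≡ using (_≡_)
open import Algebra.Morphism.Structures using (module RingMorphisms)
import Algebra.Properties.Ring as RingProperties
import Algebra.Properties.CommutativeSemigroup as CommutativeSemigroupProperties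
import Algebra.Properties.Semiring.Sum as SumProperties
import Relation.Binary.Reasoning.Setoid as SetoidReasoning

open import Defs

subsetOf : ∀ {n ℓ} {P : Pred (Fin n) ℓ} → U.Decidable P → Subset n
subsetOf {zero}  P? = []
subsetOf {suc n} P? = does (P? zero) ∷ subsetOf (P? ∘ suc)

∈-subsetOf : ∀ {n ℓ} {P : Pred (Fin n) ℓ} (P? : U.Decidable P) j → (j ∈ subsetOf P?) ⇔ P j
∈-subsetOf P? zero with P? zero
... | yes Pj = mk⇔ (λ _ → Pj) (λ _ → here)
... | no ¬Pj = mk⇔ (λ ()) (λ Pj → contradiction Pj ¬Pj)
∈-subsetOf P? (suc j) = mk⇔ (to ∘ drop-there) (there ∘ from)
  where open Equivalence (∈-subsetOf (P? ∘ suc) j)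

∉-tail : ∀ {n ℓ} {s} {p : Subset n} {P : Pred (Fin (suc n)) ℓ} →
         (∀ j → j ∉ s ∷ p → P j) → ∀ j → j ∉ p → P (suc j)
∉-tail P-off-s∷p j j∉p = P-off-s∷p (suc j) (j∉p ∘ drop-there)

⊆-ofSize : ∀ {n k} (p : Subset n) → k ≤ ∣ p ∣ → ∃[ q ] (q ⊆ p × ∣ q ∣ ≡ k)
⊆-ofSize []            z≤n     = [] , (λ ()) , ≡.refl
⊆-ofSize (outside ∷ p) k≤∣p∣   with ⊆-ofSize p k≤∣p∣
... | q , q⊆p , ∣q∣≡k = outside ∷ q , out⊆ q⊆p , ∣q∣≡k
⊆-ofSize (inside ∷ p)  z≤n     with ⊆-ofSize p z≤n
... | q , q⊆p , ∣q∣≡0 = outside ∷ q , out⊆ q⊆p , ∣q∣≡0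
⊆-ofSize (inside ∷ p)  (s≤s k≤∣p∣) with ⊆-ofSize p k≤∣p∣
... | q , q⊆p , ∣q∣≡k = inside ∷ q , in⊆in q⊆p , ≡.cong suc ∣q∣≡k

HasCard⇒≈-decidable : ∀ {c} (F : Field) → HasCard F c → Decidable (Field._≈_ F)
HasCard⇒≈-decidable F card = via-injection (Inverse⇒Injection (Inverse-sym card)) Fin._≟_

module LinearAlgebra (F : Field) where
  open Field F hiding (zero)
  open RingProperties ring using (-‿distribˡ-*)
  open CommutativeSemigroupProperties *-commutativeSemigroup
    using () renaming (x∙yz≈y∙xz to x*[y*z]≈y*[x*z])
  open CommutativeSemigroupProperties +-commutativeSemigroup
    using () renaming (x∙yz≈y∙xz to x+[y+z]≈y+[x+z])
  open SumProperties semiring using (sum; sum-cong-≋; ∑-distrib-+; *-distribˡ-sum)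
  open SetoidReasoning setoid

  Σᶠ≡sum : ∀ {k} (f : Fin k → Carrier) → Σᶠ F f ≡ sum f
  Σᶠ≡sum {zero}  f = ≡.refl
  Σᶠ≡sum {suc k} f = ≡.cong (f zero +_) (Σᶠ≡sum (f ∘ suc))

  Σᶠ-cong : ∀ {k} {f g : Fin k → Carrier} → (∀ j → f j ≈ g j) → Σᶠ F f ≈ Σᶠ F g
  Σᶠ-cong {zero}  f≈g = refl
  Σᶠ-cong {suc k} f≈g = +-cong (f≈g zero) (Σᶠ-cong (f≈g ∘ suc))

  Σᶠ-linear : ∀ {k} x y (c f g : Fin k → Carrier) →
              Σᶠ F (λ j → c j * (x * f j + y * g j)) ≈
              x * Σᶠ F (λ j → c j * f j) + y * Σᶠ F (λ j → c j * g j)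
  Σᶠ-linear {k} x y c f g = begin
    Σᶠ F (λ j → c j * (x * f j + y * g j))
      ≡⟨ Σᶠ≡sum {k} _ ⟩
    sum (λ j → c j * (x * f j + y * g j))
      ≈⟨ sum-cong-≋ {k} (λ j → trans (distribˡ (c j) _ _)
                               (+-cong (x*[y*z]≈y*[x*z] _ _ _) (x*[y*z]≈y*[x*z] _ _ _))) ⟩
    sum (λ j → x * (c j * f j) + y * (c j * g j))
      ≈⟨ ∑-distrib-+ {k} _ _ ⟩
    sum (λ j → x * (c j * f j)) + sum (λ j → y * (c j * g j))
      ≈⟨ +-cong (*-distribˡ-sum x (λ j → c j * f j)) (*-distribˡ-sum y (λ j → c j * g j)) ⟨
    x * sum (λ j → c j * f j) + y * sum (λ j → c j * g j)
      ≡⟨ ≡.cong₂ (λ s t → x * s + y * t) (Σᶠ≡sum {k} _) (Σᶠ≡sum {k} _) ⟨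
    x * Σᶠ F (λ j → c j * f j) + y * Σᶠ F (λ j → c j * g j) ∎

  Σᶠ-zero : ∀ {k} (f : Fin k → Carrier) → (∀ j → f j ≈ 0#) → Σᶠ F f ≈ 0#
  Σᶠ-zero {zero}  f f≈0 = refl
  Σᶠ-zero {suc k} f f≈0 = trans (+-cong (f≈0 zero) (Σᶠ-zero (f ∘ suc) (f≈0 ∘ suc))) (+-identityˡ 0#)

  [-x]*y≈[-y]*x : ∀ x y → (- x) * y ≈ (- y) * x
  [-x]*y≈[-y]*x x y = begin
    (- x) * y   ≈⟨ -‿distribˡ-* x y ⟨
    - (x * y)   ≈⟨ -‿cong (*-comm x y) ⟩
    - (y * x)   ≈⟨ -‿distribˡ-* y x ⟩
    (- y) * x   ∎

  x*y+[-y]*x≈0 : ∀ x y → x * y + (- y) * x ≈ 0#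
  x*y+[-y]*x≈0 x y = begin
    x * y + (- y) * x    ≈⟨ +-congˡ ([-x]*y≈[-y]*x y x) ⟩
    x * y + (- x) * y    ≈⟨ +-congˡ (-‿distribˡ-* x y) ⟨
    x * y + - (x * y)    ≈⟨ -‿inverseʳ (x * y) ⟩
    0#                   ∎

  *-cancelˡ-≉0 : ∀ {x y z} → ¬ x ≈ 0# → x * y ≈ x * z → y ≈ z
  *-cancelˡ-≉0 {x} {y} {z} x≉0 xy≈xz = begin
    y               ≈⟨ *-identityˡ y ⟨
    1# * y          ≈⟨ *-congʳ x⁻¹x≈1 ⟨
    (x⁻¹ * x) * y   ≈⟨ *-assoc x⁻¹ x y ⟩
    x⁻¹ * (x * y)   ≈⟨ *-congˡ xy≈xz ⟩
    x⁻¹ * (x * z)   ≈⟨ *-assoc x⁻¹ x z ⟨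
    (x⁻¹ * x) * z   ≈⟨ *-congʳ x⁻¹x≈1 ⟩
    1# * z          ≈⟨ *-identityˡ z ⟩
    z               ∎
    where
    x⁻¹ = proj₁ (inverse x x≉0)
    x⁻¹x≈1 : x⁻¹ * x ≈ 1#
    x⁻¹x≈1 = trans (*-comm x⁻¹ x) (proj₂ (inverse x x≉0))

  x*y≈0⇒x≈0 : ∀ {x y} → ¬ y ≈ 0# → x * y ≈ 0# → x ≈ 0#
  x*y≈0⇒x≈0 {x} {y} y≉0 xy≈0 =
    *-cancelˡ-≉0 y≉0 (trans (*-comm y x) (trans xy≈0 (sym (zeroʳ y))))

  combination : ∀ {k r} → (Fin k → Carrier) → (Fin k → Fin r → Carrier) → Fin r → Carrier
  combination c v i = Σᶠ F (λ j → c j * v j i)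

  combination-cong : ∀ {k r} (c : Fin k → Carrier) {v w : Fin k → Fin r → Carrier} →
                     (∀ j i → v j i ≈ w j i) → ∀ i → combination c v i ≈ combination c w i
  combination-cong c v≈w i = Σᶠ-cong (λ j → *-congˡ (v≈w j i))

  combination-zero : ∀ {k r} {c : Fin k → Carrier} (v : Fin k → Fin r → Carrier) →
                     (∀ j → c j ≈ 0#) → ∀ i → combination c v i ≈ 0#
  combination-zero v c≈0 i = Σᶠ-zero _ (λ j → trans (*-congʳ (c≈0 j)) (zeroˡ _))

  combination-tail : ∀ {k r} (c : Fin (suc k) → Carrier) (v : Fin (suc k) → Fin r → Carrier) {i u} →
                     c zero * v zero i ≈ 0# → combination c v i ≈ u →
                     combination (c ∘ suc) (v ∘ suc) i ≈ u
  combination-tail c v {i} head≈0 c·v≈u = begin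
    combination (c ∘ suc) (v ∘ suc) i                  ≈⟨ +-identityˡ _ ⟨
    0# + combination (c ∘ suc) (v ∘ suc) i             ≈⟨ +-congʳ head≈0 ⟨
    c zero * v zero i + combination (c ∘ suc) (v ∘ suc) i ≈⟨ c·v≈u ⟩
    _ ∎

  LinIndep-⊆ : ∀ {k r} {v : Fin k → Fin r → Carrier} {V W : Subset k} →
               V ⊆ W → LinIndep F v W → LinIndep F v V
  LinIndep-⊆ V⊆W W-indep c c-vanishes c·v≈0 j j∈V =
    W-indep c (λ j j∉W → c-vanishes j (j∉W ∘ V⊆W)) c·v≈0 j (V⊆W j∈V)

  LinIndep-vanishes : ∀ {k r} {v : Fin k → Fin r → Carrier} {W : Subset k} → LinIndep F v W →
                      ∀ {c} → (∀ j → j ∉ W → c j ≈ 0#) → (∀ i → combination c v i ≈ 0#) →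
                      ∀ j → c j ≈ 0#
  LinIndep-vanishes {W = W} W-indep c-vanishes c·v≈0 j with j ∈? W
  ... | yes j∈W = W-indep _ c-vanishes c·v≈0 j j∈W
  ... | no  j∉W = c-vanishes j j∉W

  eliminate : ∀ {r} → (Fin r → Carrier) → Fin r → (Fin r → Carrier) → Fin r → Carrier
  eliminate a p v l = a p * v l + (- a l) * v p

  eliminate-cong : ∀ {r} (a : Fin r → Carrier) p {u v : Fin r → Carrier} →
                   (∀ l → u l ≈ v l) → ∀ l → eliminate a p u l ≈ eliminate a p v l
  eliminate-cong a p u≈v l = +-cong (*-congˡ (u≈v l)) (*-congˡ (u≈v p))

  eliminate-self : ∀ {r} (a : Fin r → Carrier) p l → eliminate a p a l ≈ 0#
  eliminate-self a p l = x*y+[-y]*x≈0 (a p) (a l)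

  eliminate-zero : ∀ {r} (a : Fin r → Carrier) p l → eliminate a p (λ _ → 0#) l ≈ 0#
  eliminate-zero a p l = trans (+-cong (zeroʳ (a p)) (zeroʳ (- a l))) (+-identityʳ 0#)

  combination-eliminate : ∀ {k r} (c : Fin k → Carrier) (v : Fin k → Fin r → Carrier) a p l →
                          combination c (λ j → eliminate a p (v j)) l ≈ eliminate a p (combination c v) l
  combination-eliminate c v a p l = Σᶠ-linear (a p) (- a l) c (λ j → v j l) (λ j → v j p)

  combination-eliminate-tail :
    ∀ {k r} (c : Fin (suc k) → Carrier) (v : Fin (suc k) → Fin r → Carrier) p {u} →
    (∀ i → combination c v i ≈ u i) → ∀ l →
    combination (c ∘ suc) (λ j → eliminate (v zero) p (v (suc j))) l ≈ eliminate (v zero) p u l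
  combination-eliminate-tail c v p {u} c·v≈u l = begin
    combination (c ∘ suc) (λ j → eliminate a p (v (suc j))) l
      ≈⟨ combination-tail c (λ j → eliminate a p (v j))
           (trans (*-congˡ (eliminate-self a p l)) (zeroʳ (c zero))) refl ⟩
    combination c (λ j → eliminate a p (v j)) l   ≈⟨ combination-eliminate c v a p l ⟩
    eliminate a p (combination c v) l             ≈⟨ eliminate-cong a p c·v≈u l ⟩
    eliminate a p u l                             ∎
    where a = v zero

  eliminate-≈⇒differ-by-multiple :
    ∀ {r} {a u b : Fin r → Carrier} {p} → ¬ a p ≈ 0# →
    (∀ l → eliminate a p u l ≈ eliminate a p b l) → ∃[ t ] (∀ l → t * a l + u l ≈ b l)
  eliminate-≈⇒differ-by-multiple {a = a} {u} {b} {p} α≉0 u≈b =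
    t , λ l → *-cancelˡ-≉0 α≉0 (α*[t*al+ul]≈α*bl l)
    where
    α = a p
    α⁻¹ = proj₁ (inverse α α≉0)
    t = α⁻¹ * (b p + - u p)
    α*t≈bp-up : α * t ≈ b p + - u p
    α*t≈bp-up = trans (sym (*-assoc α α⁻¹ _)) (trans (*-congʳ (proj₂ (inverse α α≉0))) (*-identityˡ _))
    α*[t*al+ul]≈α*bl : ∀ l → α * (t * a l + u l) ≈ α * b l
    α*[t*al+ul]≈α*bl l = begin
      α * (t * a l + u l)                       ≈⟨ distribˡ α _ _ ⟩
      α * (t * a l) + α * u l                   ≈⟨ +-congʳ (trans (sym (*-assoc α t (a l))) (*-congʳ α*t≈bp-up)) ⟩
      (b p + - u p) * a l + α * u l             ≈⟨ +-congʳ (distribʳ (a l) (b p) (- u p)) ⟩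
      (b p * a l + (- u p) * a l) + α * u l     ≈⟨ +-assoc _ _ _ ⟩
      b p * a l + ((- u p) * a l + α * u l)     ≈⟨ +-congˡ (trans (+-comm _ _) (+-congˡ ([-x]*y≈[-y]*x (u p) (a l)))) ⟩
      b p * a l + eliminate a p u l             ≈⟨ +-congˡ (u≈b l) ⟩
      b p * a l + (α * b l + (- a l) * b p)     ≈⟨ x+[y+z]≈y+[x+z] _ _ _ ⟩
      α * b l + (b p * a l + (- a l) * b p)     ≈⟨ +-congˡ (x*y+[-y]*x≈0 (b p) (a l)) ⟩
      α * b l + 0#                              ≈⟨ +-identityʳ _ ⟩
      α * b l                                   ∎

module Support (F : Field) (_≟_ : Decidable (Field._≈_ F)) where
  open Field F hiding (zero)

  support : ∀ {n} → (Fin n → Carrier) → Subset n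
  support y = subsetOf (λ j → ¬? (y j ≟ 0#))

  support-isSupport : ∀ {n} (y : Fin n → Carrier) → IsSupport F y (support y)
  support-isSupport y = ∈-subsetOf _

  IsSupport⇒vanishes : ∀ {n} {y : Fin n → Carrier} {J} → IsSupport F y J → ∀ j → j ∉ J → y j ≈ 0#
  IsSupport⇒vanishes {y = y} J-supp j j∉J =
    decidable-stable (y j ≟ 0#) (j∉J ∘ Equivalence.from (J-supp j))

  support-⊆ : ∀ {n} {y : Fin n → Carrier} {W} → (∀ j → j ∉ W → y j ≈ 0#) → support y ⊆ W
  support-⊆ {y = y} {W} y-vanishes {j} j∈supp =
    decidable-stable (j ∈? W)
      (λ j∉W → Equivalence.to (support-isSupport y j) j∈supp (y-vanishes j j∉W))

module Elimination (F K : Field) (ι : Field.Carrier F → Field.Carrier K)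
               (ι-embedding : IsFieldEmbedding F K ι) (_≟_ : Decidable (Field._≈_ F)) where
  private
    module F = Field F
    module K = Field K
    module LF = LinearAlgebra F
    module LK = LinearAlgebra K
    module Embedding = RingMorphisms.IsRingMonomorphism ι-embedding

  ιᶜ : ∀ {k r} → (Fin k → Fin r → F.Carrier) → Fin k → Fin r → K.Carrier
  ιᶜ A j i = ι (A j i)

  ι-≉0 : ∀ {a} → ¬ a F.≈ F.0# → ¬ ι a K.≈ K.0#
  ι-≉0 a≉0 ιa≈0 = a≉0 (Embedding.injective (K.trans ιa≈0 (K.sym Embedding.0#-homo)))

  ι-eliminate : ∀ {r} (a v : Fin r → F.Carrier) p l →
                ι (LF.eliminate a p v l) K.≈ LK.eliminate (ι ∘ a) p (ι ∘ v) l
  ι-eliminate a v p l =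
    K.trans (Embedding.+-homo _ _)
      (K.+-cong (Embedding.*-homo _ _) (K.trans (Embedding.*-homo _ _) (K.*-congʳ (Embedding.-‿homo _))))

  combination-ι-eliminate-tail :
    ∀ {k r} (c : Fin (suc k) → K.Carrier) (A : Fin (suc k) → Fin r → F.Carrier) p {u} →
    (∀ i → LK.combination c (ιᶜ A) i K.≈ u i) → ∀ l →
    LK.combination (c ∘ suc) (ιᶜ (λ j → LF.eliminate (A zero) p (A (suc j)))) l K.≈
    LK.eliminate (ι ∘ A zero) p u l
  combination-ι-eliminate-tail c A p c·A≈u l =
    K.trans (LK.combination-cong (c ∘ suc) (λ j → ι-eliminate (A zero) (A (suc j)) p) l)
            (LK.combination-eliminate-tail c (ιᶜ A) p c·A≈u l)

  zero-or-pivot : ∀ {r} (a : Fin r → F.Carrier) → (∀ i → a i F.≈ F.0#) ⊎ ∃[ p ] ¬ a p F.≈ F.0#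
  zero-or-pivot a with all? (λ i → a i ≟ F.0#)
  ... | yes a≈0 = inj₁ a≈0
  ... | no  a≉0 = inj₂ (¬∀⟶∃¬ _ _ (λ i → a i ≟ F.0#) a≉0)

  record IndependentSolution {k r} (A : Fin k → Fin r → F.Carrier) (b : Fin r → F.Carrier)
                             (J : Subset k) : Set where
    field
      pivots             : Subset k
      pivots⊆J           : pivots ⊆ J
      pivots-independent : LinIndep K (ιᶜ A) pivots
      solution           : Fin k → F.Carrier
      solution-vanishes  : ∀ j → j ∉ pivots → solution j F.≈ F.0#
      solution-solves    : ∀ i → LF.combination solution A i F.≈ b i

  skip-first : ∀ {k r} {A : Fin (suc k) → Fin r → F.Carrier} {b J} s →
               IndependentSolution (A ∘ suc) b J → IndependentSolution A b (s ∷ J)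
  skip-first {A = A} s R = record
    { pivots             = outside ∷ pivots
    ; pivots⊆J           = out⊆ pivots⊆J
    ; pivots-independent = independent
    ; solution           = F.0# Vector.∷ solution
    ; solution-vanishes  = vanishes
    ; solution-solves    = λ i →
        F.trans (F.trans (F.+-congʳ (F.zeroˡ _)) (F.+-identityˡ _)) (solution-solves i)
    }
    where
    open IndependentSolution R
    independent : LinIndep K (ιᶜ A) (outside ∷ pivots)
    independent d d-vanishes d·A≈0 (suc j) (there j∈pivots) =
      pivots-independent (d ∘ suc) (∉-tail d-vanishes)
        (λ i → LK.combination-tail d (ιᶜ A)
                 (K.trans (K.*-congʳ (d-vanishes zero λ ())) (K.zeroˡ _)) (d·A≈0 i))
        j j∈pivots
    vanishes : ∀ j → j ∉ outside ∷ pivots → (F.0# Vector.∷ solution) j F.≈ F.0#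
    vanishes zero    _ = F.refl
    vanishes (suc j) j∉ = solution-vanishes j (j∉ ∘ there)

  pivot-first : ∀ {k r} {A : Fin (suc k) → Fin r → F.Carrier} {b J p} → ¬ A zero p F.≈ F.0# →
                IndependentSolution (λ j → LF.eliminate (A zero) p (A (suc j)))
                                    (LF.eliminate (A zero) p b) J →
                IndependentSolution A b (inside ∷ J)
  pivot-first {A = A} {b} {p = p} α≉0 R = record
    { pivots             = inside ∷ pivots
    ; pivots⊆J           = in⊆in pivots⊆J
    ; pivots-independent = independent
    ; solution           = t Vector.∷ solution
    ; solution-vanishes  = vanishes
    ; solution-solves    = t-solves
    }
    where
    open IndependentSolution R
    t-solves′ : ∃[ t ] (∀ l → t F.* A zero l F.+ LF.combination solution (A ∘ suc) l F.≈ b l)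
    t-solves′ = LF.eliminate-≈⇒differ-by-multiple α≉0 λ l →
      F.trans (F.sym (LF.combination-eliminate solution (A ∘ suc) (A zero) p l)) (solution-solves l)
    t = proj₁ t-solves′
    t-solves : ∀ l → LF.combination (t Vector.∷ solution) A l F.≈ b l
    t-solves = proj₂ t-solves′
    vanishes : ∀ j → j ∉ inside ∷ pivots → (t Vector.∷ solution) j F.≈ F.0#
    vanishes zero    0∉ = contradiction here 0∉
    vanishes (suc j) j∉ = solution-vanishes j (j∉ ∘ there)
    independent : LinIndep K (ιᶜ A) (inside ∷ pivots)
    independent d d-vanishes d·A≈0 = d≈0
      where
      d-tail≈0 : ∀ j → d (suc j) K.≈ K.0#
      d-tail≈0 = LK.LinIndep-vanishes pivots-independent (∉-tail d-vanishes) λ l →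
        K.trans (combination-ι-eliminate-tail d A p d·A≈0 l) (LK.eliminate-zero _ p l)
      d-head≈0 : d zero K.≈ K.0#
      d-head≈0 = LK.x*y≈0⇒x≈0 (ι-≉0 α≉0)
        (K.trans (K.sym (K.+-identityʳ _))
          (K.trans (K.+-congˡ (K.sym (LK.combination-zero (ιᶜ A ∘ suc) d-tail≈0 p))) (d·A≈0 p)))
      d≈0 : ∀ j → j ∈ inside ∷ pivots → d j K.≈ K.0#
      d≈0 zero    _ = d-head≈0
      d≈0 (suc j) _ = d-tail≈0 j

  independentSolution : ∀ {k r} (A : Fin k → Fin r → F.Carrier) b {J} (c : Fin k → K.Carrier) →
                        (∀ j → j ∉ J → c j K.≈ K.0#) →
                        (∀ i → LK.combination c (ιᶜ A) i K.≈ ι (b i)) →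
                        IndependentSolution A b J
  independentSolution A b {[]} c _ c·A≈b = record
    { pivots             = []
    ; pivots⊆J           = λ ()
    ; pivots-independent = λ _ _ _ _ ()
    ; solution           = λ ()
    ; solution-vanishes  = λ ()
    ; solution-solves    = λ i → Embedding.injective (K.trans Embedding.0#-homo (c·A≈b i))
    }
  independentSolution A b {outside ∷ J} c c-vanishes c·A≈b =
    skip-first outside (independentSolution (A ∘ suc) b (c ∘ suc) (∉-tail c-vanishes) λ i →
      LK.combination-tail c (ιᶜ A) (K.trans (K.*-congʳ (c-vanishes zero λ ())) (K.zeroˡ _)) (c·A≈b i))
  independentSolution A b {inside ∷ J} c c-vanishes c·A≈b with zero-or-pivot (A zero)
  ... | inj₁ A₀≈0 =
    skip-first inside (independentSolution (A ∘ suc) b (c ∘ suc) (∉-tail c-vanishes) λ i →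
      LK.combination-tail c (ιᶜ A) (K.trans (K.*-congˡ ιA₀≈0) (K.zeroʳ _)) (c·A≈b i))
    where
    ιA₀≈0 : ∀ {i} → ι (A zero i) K.≈ K.0#
    ιA₀≈0 {i} = K.trans (Embedding.⟦⟧-cong (A₀≈0 i)) Embedding.0#-homo
  ... | inj₂ (p , A₀p≉0) =
    pivot-first A₀p≉0 (independentSolution _ _ (c ∘ suc) (∉-tail c-vanishes) λ l →
      K.trans (combination-ι-eliminate-tail c A p c·A≈b l) (K.sym (ι-eliminate (A zero) b p l)))

mainTheorem7 :
    (q m : ℕ) → IsPrimePower q →
    (Fq FQ : Field) → HasCard Fq q → HasCard FQ (q ^ m) →
    (ι : Field.Carrier Fq → Field.Carrier FQ) → IsFieldEmbedding Fq FQ ι →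
    (r n : ℕ) →
    (H : Fin r → Fin n → Field.Carrier Fq) →
    (s : Fin r → Field.Carrier Fq) →
    (β : Fin n → Field.Carrier FQ) →
    (x : Fin n → Field.Carrier FQ) →
    (∀ i → Field._≈_ FQ
             (Σᶠ FQ (λ j → Field._*_ FQ (Field._*_ FQ (β j) (ι (H i j))) (x j)))
             (ι (s i))) →
    (wH : ℕ) →
    (∃[ y ] ((∀ i → Field._≈_ Fq (Σᶠ Fq (λ j → Field._*_ Fq (H i j) (y j))) (s i))
             × HasWeight Fq y wH)) →
    (∀ (y : Fin n → Field.Carrier Fq) →
       (∀ i → Field._≈_ Fq (Σᶠ Fq (λ j → Field._*_ Fq (H i j) (y j))) (s i)) →
       ∀ w → HasWeight Fq y w → wH ≤ w) →
    (J : Subset n) → IsSupport FQ x J →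
    ∃[ W ] (W ⊆ J × ∣ W ∣ ≡ wH × LinIndep FQ (λ j i → ι (H i j)) W)
mainTheorem7 q m _ Fq FQ Fq-card FQ-card ι ι-embedding r n H s β x Hβx≈s wH _ wH-minimal J x-supp =
  let V , V⊆pivots , ∣V∣≡wH = ⊆-ofSize pivots wH≤∣pivots∣
  in  V , ⊆-trans V⊆pivots pivots⊆J , ∣V∣≡wH , LinearAlgebra.LinIndep-⊆ FQ V⊆pivots pivots-independent
  where
  module Fq = Field Fq
  module FQ = Field FQ
  _≟q_ = HasCard⇒≈-decidable Fq Fq-card
  _≟Q_ = HasCard⇒≈-decidable FQ FQ-card
  open Elimination Fq FQ ι ι-embedding _≟q_
  open Support Fq _≟q_ using (support; support-isSupport; support-⊆)

  βx-vanishes : ∀ j → j ∉ J → β j FQ.* x j FQ.≈ FQ.0#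
  βx-vanishes j j∉J =
    FQ.trans (FQ.*-congˡ (Support.IsSupport⇒vanishes FQ _≟Q_ x-supp j j∉J)) (FQ.zeroʳ (β j))

  βx-solves : ∀ i → Σᶠ FQ (λ j → (β j FQ.* x j) FQ.* ι (H i j)) FQ.≈ ι (s i)
  βx-solves i = FQ.trans (LinearAlgebra.Σᶠ-cong FQ {n} λ j →
    CommutativeSemigroupProperties.xy∙z≈xz∙y FQ.*-commutativeSemigroup (β j) (x j) (ι (H i j))) (Hβx≈s i)

  open IndependentSolution (independentSolution (λ j i → H i j) s (λ j → β j FQ.* x j) βx-vanishes βx-solves)

  H·solution≈s : ∀ i → Σᶠ Fq (λ j → H i j Fq.* solution j) Fq.≈ s i
  H·solution≈s i =
    Fq.trans (LinearAlgebra.Σᶠ-cong Fq {n} λ j → Fq.*-comm (H i j) (solution j)) (solution-solves i)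

  wH≤∣pivots∣ : wH ≤ ∣ pivots ∣
  wH≤∣pivots∣ =
    ≤-trans (wH-minimal solution H·solution≈s _ (support solution , support-isSupport solution , ≡.refl))
            (p⊆q⇒∣p∣≤∣q∣ (support-⊆ solution-vanishes))
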